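{- For every integer $k\ge 6$, the path $P_k$ defines each of the graphs $K_{1,3}$, $K_3$, $K_4-e$ and $P_2\cup P_3$; that is, for each such graph $H$ there is a coalition partition $\Psi$ of $P_k$ with $\mathrm{CG}(P_k,\Psi)\cong H$.
   Context: For a graph $G$ with vertex set $V$, a set $S\subseteq V$ is a dominating set if every vertex of $V\setminus S$ is adjacent to a vertex of $S$. Two disjoint sets $V_1,V_2\subseteq V$ form a coalition in $G$ if neither is a dominating set of $G$ but $V_1\cup V_2$ is. A coalition partition of $G$ is a partition $\Psi=\{V_1,\ldots,V_k\}$ of $V$ such that every $V_i\in\Psi$ is either a dominating set of $G$ with $|V_i|=1$, or is not a dominating set and forms a coalition with some $V_j\in\Psi$. Given a coalition partition $\Psi$ of $G$, the coalition graph $\mathrm{CG}(G,\Psi)$ has vertex set $\Psi$, two members adjacent iff they form a coalition in $G$. $P_k$ is the path on $k$ vertices; $K_4-e$ is $K_4$ with one edge removed; $P_2\cup P_3$ is the disjoint union of paths on $2$ and $3$ vertices. -}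

module Defs where

open import Data.Nat using (ℕ; suc; _≤_)
open import Data.Fin using (Fin; toℕ)
open import Data.Product using (Σ; ∃; _×_; _,_)
open import Data.Sum using (_⊎_)
open import Data.Bool using (Bool; true; false; T)
open import Relation.Nullary using (¬_)
open import Relation.Binary.PropositionalEquality using (_≡_; _≢_)
open import Function.Bundles using (_⤖_; _⇔_; Bijection)

record Graph : Set₁ where
  field
    n    : ℕ
    Adj  : Fin n → Fin n → Set
    sym  : ∀ {u v} → Adj u v → Adj v u
    irr  : ∀ {v} → ¬ Adj v v
open Graph public

PathAdj : ∀ {k} → Fin k → Fin k → Set
PathAdj i j = (suc (toℕ i) ≡ toℕ j) ⊎ (suc (toℕ j) ≡ toℕ i)

Dominating : (G : Graph) → (Fin (n G) → Set) → Set
Dominating G S = ∀ v → S v ⊎ ∃ λ u → S u × Adj G u v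

-- A partition of V(G) into m classes, given by a class-labelling
-- f : V → Fin m; every class is nonempty.
Class : {G : Graph} {m : ℕ} → (Fin (n G) → Fin m) → Fin m → Fin (n G) → Set
Class f i v = f v ≡ i

Union : {A : Set} → (A → Set) → (A → Set) → A → Set
Union S T v = S v ⊎ T v

Coalition : (G : Graph) {m : ℕ} → (Fin (n G) → Fin m) → Fin m → Fin m → Set
Coalition G f i j =
  i ≢ j × ¬ Dominating G (Class {G} f i) × ¬ Dominating G (Class {G} f j)
        × Dominating G (Union (Class {G} f i) (Class {G} f j))

Singleton : (G : Graph) {m : ℕ} → (Fin (n G) → Fin m) → Fin m → Set
Singleton G f i = ∃ λ v → f v ≡ i × (∀ u → f u ≡ i → u ≡ v)

IsCoalitionPartition : (G : Graph) {m : ℕ} → (Fin (n G) → Fin m) → Set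
IsCoalitionPartition G {m} f =
  (∀ (i : Fin m) → ∃ λ v → f v ≡ i)
  × (∀ (i : Fin m) →
       (Dominating G (Class {G} f i) × Singleton G f i)
       ⊎ (¬ Dominating G (Class {G} f i) × ∃ λ j → Coalition G f i j))

CGIso : (G : Graph) {m : ℕ} → (Fin (n G) → Fin m) → Graph → Set
CGIso G {m} f H =
  Σ (Fin m ⤖ Fin (n H)) λ φ →
    ∀ i j → Coalition G f i j ⇔ Adj H (Bijection.to φ i) (Bijection.to φ j)

Defines : Graph → Graph → Set
Defines G H = ∃ λ (m : ℕ) → ∃ λ (f : Fin (n G) → Fin m) →
  IsCoalitionPartition G f × CGIso G f H

BAdj : ∀ {n} → (ℕ → ℕ → Bool) → Fin n → Fin n → Set
BAdj e i j = T (e (toℕ i) (toℕ j))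

k13 : ℕ → ℕ → Bool
k13 0 1 = true
k13 0 2 = true
k13 0 3 = true
k13 1 0 = true
k13 2 0 = true
k13 3 0 = true
k13 _ _ = false

k3 : ℕ → ℕ → Bool
k3 0 1 = true
k3 0 2 = true
k3 1 0 = true
k3 1 2 = true
k3 2 0 = true
k3 2 1 = true
k3 _ _ = false

k4e : ℕ → ℕ → Bool
k4e 0 2 = true
k4e 0 3 = true
k4e 1 2 = true
k4e 1 3 = true
k4e 2 3 = true
k4e 2 0 = true
k4e 3 0 = true
k4e 2 1 = true
k4e 3 1 = true
k4e 3 2 = true
k4e _ _ = false

p2p3 : ℕ → ℕ → Bool
p2p3 0 1 = true
p2p3 1 0 = true
p2p3 2 3 = true
p2p3 3 2 = true
p2p3 3 4 = true
p2p3 4 3 = true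
p2p3 _ _ = false

open import Data.Fin using (zero; suc)

module _ where
  private
    F4 = Fin 4
  k13-sym : ∀ {u v : Fin 4} → BAdj k13 u v → BAdj k13 v u
  k13-sym {zero} {suc zero} t = t
  k13-sym {zero} {suc (suc zero)} t = t
  k13-sym {zero} {suc (suc (suc zero))} t = t
  k13-sym {suc zero} {zero} t = t
  k13-sym {suc (suc zero)} {zero} t = t
  k13-sym {suc (suc (suc zero))} {zero} t = t

  k13-irr : ∀ {v : Fin 4} → ¬ BAdj k13 v v
  k13-irr {zero} ()
  k13-irr {suc zero} ()
  k13-irr {suc (suc zero)} ()
  k13-irr {suc (suc (suc zero))} ()

  k3-sym : ∀ {u v : Fin 3} → BAdj k3 u v → BAdj k3 v u
  k3-sym {zero} {suc zero} t = t
  k3-sym {zero} {suc (suc zero)} t = t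
  k3-sym {suc zero} {zero} t = t
  k3-sym {suc zero} {suc (suc zero)} t = t
  k3-sym {suc (suc zero)} {zero} t = t
  k3-sym {suc (suc zero)} {suc zero} t = t

  k3-irr : ∀ {v : Fin 3} → ¬ BAdj k3 v v
  k3-irr {zero} ()
  k3-irr {suc zero} ()
  k3-irr {suc (suc zero)} ()

  k4e-sym : ∀ {u v : Fin 4} → BAdj k4e u v → BAdj k4e v u
  k4e-sym {zero} {suc (suc zero)} t = t
  k4e-sym {zero} {suc (suc (suc zero))} t = t
  k4e-sym {suc zero} {suc (suc zero)} t = t
  k4e-sym {suc zero} {suc (suc (suc zero))} t = t
  k4e-sym {suc (suc zero)} {zero} t = t
  k4e-sym {suc (suc zero)} {suc zero} t = t
  k4e-sym {suc (suc zero)} {suc (suc (suc zero))} t = t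
  k4e-sym {suc (suc (suc zero))} {zero} t = t
  k4e-sym {suc (suc (suc zero))} {suc zero} t = t
  k4e-sym {suc (suc (suc zero))} {suc (suc zero)} t = t

  k4e-irr : ∀ {v : Fin 4} → ¬ BAdj k4e v v
  k4e-irr {zero} ()
  k4e-irr {suc zero} ()
  k4e-irr {suc (suc zero)} ()
  k4e-irr {suc (suc (suc zero))} ()

  p2p3-sym : ∀ {u v : Fin 5} → BAdj p2p3 u v → BAdj p2p3 v u
  p2p3-sym {zero} {suc zero} t = t
  p2p3-sym {suc zero} {zero} t = t
  p2p3-sym {suc (suc zero)} {suc (suc (suc zero))} t = t
  p2p3-sym {suc (suc (suc zero))} {suc (suc zero)} t = t
  p2p3-sym {suc (suc (suc zero))} {suc (suc (suc (suc zero)))} t = t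
  p2p3-sym {suc (suc (suc (suc zero)))} {suc (suc (suc zero))} t = t

  p2p3-irr : ∀ {v : Fin 5} → ¬ BAdj p2p3 v v
  p2p3-irr {zero} ()
  p2p3-irr {suc zero} ()
  p2p3-irr {suc (suc zero)} ()
  p2p3-irr {suc (suc (suc zero))} ()
  p2p3-irr {suc (suc (suc (suc zero)))} ()

open import Data.Sum using (inj₁; inj₂)
open import Relation.Binary.PropositionalEquality using (refl)
open import Data.Nat.Properties using (1+n≢n)

path-sym : ∀ {k} {u v : Fin k} → PathAdj u v → PathAdj v u
path-sym (inj₁ p) = inj₂ p
path-sym (inj₂ p) = inj₁ p

path-irr : ∀ {k} {v : Fin k} → ¬ PathAdj v v
path-irr {v = v} (inj₁ p) = 1+n≢n p
path-irr {v = v} (inj₂ p) = 1+n≢n p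

P : ℕ → Graph
P k = record { n = k ; Adj = PathAdj ; sym = path-sym ; irr = path-irr }

K13 K3 K4-e P2∪P3 : Graph
K13 = record { n = 4 ; Adj = BAdj k13 ; sym = k13-sym ; irr = k13-irr }
K3 = record { n = 3 ; Adj = BAdj k3 ; sym = k3-sym ; irr = k3-irr }
K4-e = record { n = 4 ; Adj = BAdj k4e ; sym = k4e-sym ; irr = k4e-irr }
P2∪P3 = record { n = 5 ; Adj = BAdj p2p3 ; sym = p2p3-sym ; irr = p2p3-irr }

-- Label the vertices 0, …, k-1 of P_k so that from vertex 4 on the labels
-- alternate between two classes. Every vertex from 5 on then sees in its closed
-- neighbourhood exactly the labels that vertex 5 sees in the one-way infinite
-- path, so for k ≥ 6 a union of classes dominates P_k iff it dominates vertices
-- 0, …, 5 of that infinite path. Hence the coalition graph of such a labelling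
-- does not depend on k and is computed once and for all; one explicit labelling
-- per target graph finishes the proof.
module Submission where

open import Defs hiding (sym)
open import Data.Bool using (Bool; true; false; T; not; _∧_; _∨_)
open import Data.Bool.Properties using (T-∧; T-∨) renaming (_≟_ to _≟ᵇ_)
open import Data.Fin using (Fin; toℕ; fromℕ<; inject≤; inject₁; #_)
open import Data.Fin.Properties using (all?; any?; toℕ<n; toℕ-fromℕ<; toℕ-inject≤; toℕ-inject₁)
  renaming (_≟_ to _≟ᶠ_)
open import Data.Nat using (ℕ; zero; suc; _+_; _≤_; _<_; s≤s)
open import Data.Nat.Properties using (≤-trans; <⇒≤)
open import Data.Product using (∃; _×_; _,_; proj₁; proj₂)
open import Data.Product.Function.NonDependent.Propositional using (_×-⇔_)
open import Data.Sum using (_⊎_; inj₁; inj₂)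
open import Data.Sum.Function.Propositional using (_⊎-⇔_)
open import Data.Unit using (tt)
open import Data.Vec using (Vec; []; _∷_; lookup)
open import Function using (_∘_)
open import Function.Bundles using (_⇔_; mk⇔; Equivalence)
open import Function.Construct.Composition using (_⇔-∘_)
open import Function.Construct.Identity using (⤖-id)
open import Function.Construct.Symmetry using (⇔-sym)
open import Function.Related.TypeIsomorphisms using (¬-cong-⇔)
open import Relation.Nullary using (¬_; Dec; yes; no; does)
open import Relation.Nullary.Decidable using (True; T?; toWitness; _×-dec_)
open import Relation.Binary.PropositionalEquality using (_≡_; refl; sym; trans; subst; cong)

open Equivalence using (to; from)

T-does : ∀ {A : Set} (a? : Dec A) → T (does a?) ⇔ A
T-does (yes a) = mk⇔ (λ _ → a) (λ _ → tt)
T-does (no ¬a) = mk⇔ (λ ()) ¬a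

T-not : ∀ {b} → T (not b) ⇔ (¬ T b)
T-not {false} = mk⇔ (λ _ ()) (λ _ → tt)
T-not {true}  = mk⇔ (λ ()) (λ ¬t → ¬t tt)

T-∧-cong : ∀ {a b} {A B : Set} → T a ⇔ A → T b ⇔ B → T (a ∧ b) ⇔ (A × B)
T-∧-cong a⇔A b⇔B = (a⇔A ×-⇔ b⇔B) ⇔-∘ T-∧

T-∨-cong : ∀ {a b} {A B : Set} → T a ⇔ A → T b ⇔ B → T (a ∨ b) ⇔ (A ⊎ B)
T-∨-cong a⇔A b⇔B = (a⇔A ⊎-⇔ b⇔B) ⇔-∘ T-∨

T-cong : ∀ {a b} → a ≡ b → T a ⇔ T b
T-cong refl = mk⇔ (λ t → t) (λ t → t)

DominatedBy : (G : Graph) → (Fin (n G) → Set) → Fin (n G) → Set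
DominatedBy G S v = S v ⊎ ∃ λ u → S u × Adj G u v

DominatedBy-mono : ∀ {G} {S S′ : Fin (n G) → Set} → (∀ {v} → S v → S′ v) →
  ∀ {v} → DominatedBy G S v → DominatedBy G S′ v
DominatedBy-mono S⊆S′ (inj₁ s)           = inj₁ (S⊆S′ s)
DominatedBy-mono S⊆S′ (inj₂ (u , s , a)) = inj₂ (u , S⊆S′ s , a)

Dominating-cong : ∀ {G} {S S′ : Fin (n G) → Set} → (∀ v → S v ⇔ S′ v) →
  Dominating G S ⇔ Dominating G S′
Dominating-cong {G} S⇔S′ = mk⇔
  (λ d v → DominatedBy-mono {G} (to (S⇔S′ _)) (d v))
  (λ d v → DominatedBy-mono {G} (from (S⇔S′ _)) (d v))

dominatedAt : (ℕ → Bool) → ℕ → Bool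
dominatedAt S zero    = S 0 ∨ S 1
dominatedAt S (suc n) = S n ∨ S (suc n) ∨ S (suc (suc n))

module _ (S : ℕ → Bool) where

  dominatedAt-self : ∀ n → T (S n) → T (dominatedAt S n)
  dominatedAt-self zero    s = from (T-∨ {S 0}) (inj₁ s)
  dominatedAt-self (suc n) s = from (T-∨ {S n}) (inj₂ (from (T-∨ {S (suc n)}) (inj₁ s)))

  dominatedAt-left : ∀ n → T (S n) → T (dominatedAt S (suc n))
  dominatedAt-left n s = from (T-∨ {S n}) (inj₁ s)

  dominatedAt-right : ∀ n → T (S (suc n)) → T (dominatedAt S n)
  dominatedAt-right zero    s = from (T-∨ {S 0}) (inj₂ s)
  dominatedAt-right (suc n) s = from (T-∨ {S n}) (inj₂ (from (T-∨ {S (suc n)}) (inj₂ s)))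

  DominatesPrefix : Set
  DominatesPrefix = ∀ (i : Fin 6) → T (dominatedAt S (toℕ i))

  dominatesPrefix? : Dec DominatesPrefix
  dominatesPrefix? = all? (λ i → T? (dominatedAt S (toℕ i)))

AlternatesFrom4 : {A : Set} → (ℕ → A) → Set
AlternatesFrom4 s = ∀ n → s (6 + n) ≡ s (4 + n)

alternatingFrom4 : {A : Set} → Vec A 6 → ℕ → A
alternatingFrom4 c 0 = lookup c (# 0)
alternatingFrom4 c 1 = lookup c (# 1)
alternatingFrom4 c 2 = lookup c (# 2)
alternatingFrom4 c 3 = lookup c (# 3)
alternatingFrom4 c 4 = lookup c (# 4)
alternatingFrom4 c 5 = lookup c (# 5)
alternatingFrom4 c (suc (suc (suc (suc (suc (suc n)))))) =
  alternatingFrom4 c (suc (suc (suc (suc n))))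

alternatingFrom4-alternates : ∀ {A : Set} (c : Vec A 6) → AlternatesFrom4 (alternatingFrom4 c)
alternatingFrom4-alternates c n = refl

alternating-tail : ∀ {S : ℕ → Bool} → AlternatesFrom4 S → T (dominatedAt S 5) →
  ∀ n → T (S (4 + n)) ⊎ T (S (5 + n))
alternating-tail {S} alt d zero with to (T-∨ {S 4}) d
... | inj₁ s₄ = inj₁ s₄
... | inj₂ d′ with to (T-∨ {S 5}) d′
...   | inj₁ s₅ = inj₂ s₅
...   | inj₂ s₆ = inj₁ (subst T (alt 0) s₆)
alternating-tail {S} alt d (suc n) with alternating-tail {S} alt d n
... | inj₁ s = inj₂ (subst T (sym (alt n)) s)
... | inj₂ s = inj₁ s

module _ {k : ℕ} (S : ℕ → Bool) where

  onPath : Fin k → Set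
  onPath v = T (S (toℕ v))

  byItself : ∀ {v n} → toℕ v ≡ n → T (S n) → DominatedBy (P k) onPath v
  byItself eq s = inj₁ (subst (T ∘ S) (sym eq) s)

  byLeft : ∀ {v n} → toℕ v ≡ suc n → T (S n) → DominatedBy (P k) onPath v
  byLeft {v} {n} eq s =
    inj₂ (fromℕ< n<k , subst (T ∘ S) (sym (toℕ-fromℕ< n<k)) s ,
          inj₁ (trans (cong suc (toℕ-fromℕ< n<k)) (sym eq)))
    where
    n<k : n < k
    n<k = <⇒≤ (subst (_< k) eq (toℕ<n v))

  byRight : ∀ {v n} → toℕ v ≡ n → suc n < k → T (S (suc n)) → DominatedBy (P k) onPath v
  byRight eq n+1<k s =
    inj₂ (fromℕ< n+1<k , subst (T ∘ S) (sym (toℕ-fromℕ< n+1<k)) s ,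
          inj₂ (trans (cong suc eq) (sym (toℕ-fromℕ< n+1<k))))

  dominatedAt-sound : ∀ {v} n → toℕ v ≡ n → suc n < k → T (dominatedAt S n) →
    DominatedBy (P k) onPath v
  dominatedAt-sound zero eq lt d with to (T-∨ {S 0}) d
  ... | inj₁ s = byItself eq s
  ... | inj₂ s = byRight eq lt s
  dominatedAt-sound (suc n) eq lt d with to (T-∨ {S n}) d
  ... | inj₁ s = byLeft eq s
  ... | inj₂ d′ with to (T-∨ {S (suc n)}) d′
  ...   | inj₁ s = byItself eq s
  ...   | inj₂ s = byRight eq lt s

  dominatedAt-complete : ∀ {v} → DominatedBy (P k) onPath v → T (dominatedAt S (toℕ v))
  dominatedAt-complete (inj₁ s) = dominatedAt-self S _ s
  dominatedAt-complete (inj₂ (u , s , inj₁ e)) =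
    subst (T ∘ dominatedAt S) e (dominatedAt-left S _ s)
  dominatedAt-complete (inj₂ (u , s , inj₂ e)) =
    dominatedAt-right S _ (subst (T ∘ S) (sym e) s)

  dominatesPrefix⇔Dominating : 6 ≤ k → AlternatesFrom4 S →
    DominatesPrefix S ⇔ Dominating (P k) onPath
  dominatesPrefix⇔Dominating 6≤k alt = mk⇔ sound complete
    where
    complete : Dominating (P k) onPath → DominatesPrefix S
    complete d i = subst (T ∘ dominatedAt S) (toℕ-inject≤ i 6≤k)
                         (dominatedAt-complete (d (inject≤ i 6≤k)))

    sound : DominatesPrefix S → Dominating (P k) onPath
    sound h v = go (toℕ v) refl
      where
      nearStart : ∀ (i : Fin 5) → toℕ v ≡ toℕ i → DominatedBy (P k) onPath v
      nearStart i eq =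
        dominatedAt-sound (toℕ i) eq (≤-trans (s≤s (toℕ<n i)) 6≤k)
          (subst (T ∘ dominatedAt S) (toℕ-inject₁ i) (h (inject₁ i)))

      go : ∀ n → toℕ v ≡ n → DominatedBy (P k) onPath v
      go 0 = nearStart (# 0)
      go 1 = nearStart (# 1)
      go 2 = nearStart (# 2)
      go 3 = nearStart (# 3)
      go 4 = nearStart (# 4)
      go (suc (suc (suc (suc (suc n))))) eq with alternating-tail {S} alt (h (# 5)) n
      ... | inj₁ s = byLeft eq s
      ... | inj₂ s = byItself eq s

  dominatesPrefix?⇔Dominating : ∀ {X : Fin k → Set} → 6 ≤ k → AlternatesFrom4 S →
    (∀ v → onPath v ⇔ X v) → T (does (dominatesPrefix? S)) ⇔ Dominating (P k) X
  dominatesPrefix?⇔Dominating 6≤k alt S⇔X =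
    Dominating-cong {P k} S⇔X ⇔-∘
    (dominatesPrefix⇔Dominating 6≤k alt ⇔-∘ T-does (dominatesPrefix? S))

coalitionGraph⇒defines : ∀ {G H} (f : Fin (n G) → Fin (n H)) → (∀ i → ∃ λ v → f v ≡ i) →
  (∀ i j → Coalition G f i j ⇔ Adj H i j) → (∀ x → ∃ λ y → Adj H x y) → Defines G H
coalitionGraph⇒defines {G} f onto coalition⇔adj noIsolated =
  _ , f , (onto , λ i → let (j , c) = partner i in inj₂ (proj₁ (proj₂ c) , j , c)) ,
  ⤖-id _ , coalition⇔adj
  where
  partner : ∀ i → ∃ λ j → Coalition G f i j
  partner i = let (j , a) = noIsolated i in j , from (coalition⇔adj i j) a

module _ {m : ℕ} (g : ℕ → Fin m) where

  inClass : Fin m → ℕ → Bool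
  inClass i n = does (g n ≟ᶠ i)

  coalition? : Fin m → Fin m → Bool
  coalition? i j = not (does (i ≟ᶠ j))
                 ∧ not (does (dominatesPrefix? (inClass i)))
                 ∧ not (does (dominatesPrefix? (inClass j)))
                 ∧ does (dominatesPrefix? (λ n → inClass i n ∨ inClass j n))

  coalition?⇔Coalition : ∀ {k} → 6 ≤ k → AlternatesFrom4 g →
    ∀ i j → T (coalition? i j) ⇔ Coalition (P k) (g ∘ toℕ) i j
  coalition?⇔Coalition {k} 6≤k alt i j =
    T-∧-cong (¬-cong-⇔ (T-does (i ≟ᶠ j)) ⇔-∘ T-not)
      (T-∧-cong (¬-cong-⇔ (dominatesClass i) ⇔-∘ T-not)
        (T-∧-cong (¬-cong-⇔ (dominatesClass j) ⇔-∘ T-not)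
          (dominatesPrefix?⇔Dominating (λ n → inClass i n ∨ inClass j n) 6≤k
            (λ n → cong (λ x → does (x ≟ᶠ i) ∨ does (x ≟ᶠ j)) (alt n))
            (λ v → T-∨-cong (T-does (g (toℕ v) ≟ᶠ i)) (T-does (g (toℕ v) ≟ᶠ j))))))
    where
    dominatesClass : ∀ i → T (does (dominatesPrefix? (inClass i))) ⇔
                           Dominating (P k) (Class {P k} (g ∘ toℕ) i)
    dominatesClass i = dominatesPrefix?⇔Dominating (inClass i) 6≤k
      (λ n → cong (λ x → does (x ≟ᶠ i)) (alt n)) (λ v → T-does (g (toℕ v) ≟ᶠ i))

module _ (H : Graph) (adj? : ∀ x y → Dec (Adj H x y)) (c : Vec (Fin (n H)) 6) where

  Realises : Set
  Realises = (∀ i → ∃ λ (v : Fin 6) → alternatingFrom4 c (toℕ v) ≡ i)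
           × (∀ i j → coalition? (alternatingFrom4 c) i j ≡ does (adj? i j))
           × (∀ i → ∃ λ j → Adj H i j)

  realises? : Dec Realises
  realises? = all? (λ i → any? (λ v → alternatingFrom4 c (toℕ v) ≟ᶠ i))
        ×-dec all? (λ i → all? (λ j → coalition? (alternatingFrom4 c) i j ≟ᵇ does (adj? i j)))
        ×-dec all? (λ i → any? (adj? i))

  realises⇒defines : ∀ {k} → 6 ≤ k → Realises → Defines (P k) H
  realises⇒defines {k} 6≤k (hits , agrees , noIsolated) =
    coalitionGraph⇒defines {P k} {H} (g ∘ toℕ) onto
      (λ i j → T-does (adj? i j) ⇔-∘ (T-cong (agrees i j) ⇔-∘
                 ⇔-sym (coalition?⇔Coalition g 6≤k (alternatingFrom4-alternates c) i j)))
      noIsolated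
    where
    g : ℕ → Fin (n H)
    g = alternatingFrom4 c

    onto : ∀ i → ∃ λ v → g (toℕ v) ≡ i
    onto i = let (v , gv≡i) = hits i in
      inject≤ v 6≤k , trans (cong g (toℕ-inject≤ v 6≤k)) gv≡i

  path-defines : ∀ {k} → 6 ≤ k → {True realises?} → Defines (P k) H
  path-defines 6≤k {realises} = realises⇒defines 6≤k (toWitness realises)

BAdj? : ∀ {m} (e : ℕ → ℕ → Bool) (x y : Fin m) → Dec (BAdj e x y)
BAdj? e x y = T? (e (toℕ x) (toℕ y))

proposition7 : (k : ℕ) → 6 ≤ k →
    Defines (P k) K13 × Defines (P k) K3 × Defines (P k) K4-e × Defines (P k) P2∪P3
proposition7 k 6≤k =
  path-defines K13   (BAdj? k13)  (# 0 ∷ # 1 ∷ # 2 ∷ # 3 ∷ # 0 ∷ # 0 ∷ []) 6≤k ,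
  path-defines K3    (BAdj? k3)   (# 0 ∷ # 2 ∷ # 2 ∷ # 1 ∷ # 0 ∷ # 1 ∷ []) 6≤k ,
  path-defines K4-e  (BAdj? k4e)  (# 2 ∷ # 3 ∷ # 0 ∷ # 1 ∷ # 2 ∷ # 3 ∷ []) 6≤k ,
  path-defines P2∪P3 (BAdj? p2p3) (# 3 ∷ # 1 ∷ # 2 ∷ # 4 ∷ # 0 ∷ # 3 ∷ []) 6≤k
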